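{- Let $Q$ be a (possibly starred) quiver with normal vertices $v_1,\dots,v_n$. Then every lattice point of $\mathrm{Root}(Q)$ (i.e. every point of $\mathrm{Root}(Q)\cap\mathbb Z^n$) is either the origin $\mathbf 0$ or one of the points $u_a$, $a\in\mathrm{Arr}(Q)$.
   Context: A quiver $Q$ has normal vertices $v_1,\dots,v_n$ ($n\ge1$), a possibly empty set of starred vertices, and arrows $\mathrm{Arr}(Q)$ each going normal-to-normal, normal-to-starred or starred-to-normal (never starred-to-starred); no loops, no repeated arrows, connected underlying graph. For each arrow $a$ define $u_a\in\mathbb R^n$: $u_a=e_j-e_i$ if $a:v_i\to v_j$; $u_a=e_j$ if $a$ goes from a starred vertex to $v_j$; $u_a=-e_i$ if $a$ goes from $v_i$ to a starred vertex. The root polytope is $\mathrm{Root}(Q)=\mathrm{Conv}\{u_a : a\in\mathrm{Arr}(Q)\}\subset\mathbb R^n$.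
   Formalization: Membership of a lattice point in $\mathrm{Root}(Q)$ requires a convex combination of the points $u_a$ with rational weights rather than real ones. -}

module Defs where

open import Data.Nat using (ℕ; zero; suc)
open import Data.Fin using (Fin)
open import Data.Sum using (_⊎_; inj₁; inj₂)
open import Data.Product using (_×_; ∃-syntax)
open import Data.Integer using (ℤ; +_; -_)
open import Data.Rational using (ℚ; 0ℚ; _+_; _*_; _/_)
open import Relation.Binary.PropositionalEquality using (_≡_; _≢_)
open import Relation.Nullary using (¬_)
open import Function.Definitions using (Injective)

-- An arrow of a (possibly starred) quiver with normal vertices Fin n
-- (v_1..v_n) and starred vertices Fin m (m may be 0).
data Arrow (n m : ℕ) : Set where
  nn  : Fin n → Fin n → Arrow n m
  sn  : Fin m → Fin n → Arrow n m
  ns  : Fin n → Fin m → Arrow n m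

Vertex : ℕ → ℕ → Set
Vertex n m = Fin n ⊎ Fin m

source : ∀ {n m} → Arrow n m → Vertex n m
source (nn i j) = inj₁ i
source (sn s j) = inj₂ s
source (ns i s) = inj₁ i

target : ∀ {n m} → Arrow n m → Vertex n m
target (nn i j) = inj₁ j
target (sn s j) = inj₁ j
target (ns i s) = inj₂ s

record Quiver (n m : ℕ) : Set where
  field
    k       : ℕ
    arr     : Fin k → Arrow n m
    noRep   : Injective _≡_ _≡_ arr
    noLoop  : ∀ (a : Fin k) → source (arr a) ≢ target (arr a)

data Reach {n m : ℕ} (Q : Quiver n m) (x : Vertex n m) : Vertex n m → Set where
  here : Reach Q x x
  fwd  : ∀ {y} (a : Fin (Quiver.k Q)) → Reach Q x y →
         source (Quiver.arr Q a) ≡ y → Reach Q x (target (Quiver.arr Q a))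
  bwd  : ∀ {y} (a : Fin (Quiver.k Q)) → Reach Q x y →
         target (Quiver.arr Q a) ≡ y → Reach Q x (source (Quiver.arr Q a))

Connected : ∀ {n m} → Quiver n m → Set
Connected Q = ∀ x y → Reach Q x y

δ : ∀ {n} → Fin n → Fin n → ℤ
δ Fin.zero Fin.zero = + 1
δ Fin.zero (Fin.suc _) = + 0
δ (Fin.suc _) Fin.zero = + 0
δ (Fin.suc i) (Fin.suc j) = δ i j

u : ∀ {n m} → Arrow n m → Fin n → ℤ
u (nn i j) l = δ j l Data.Integer.+ (- δ i l)
u (sn s j) l = δ j l
u (ns i s) l = - δ i l

toℚ : ℤ → ℚ
toℚ z = z / 1

Σℚ : ∀ {k} → (Fin k → ℚ) → ℚ
Σℚ {zero} f = 0ℚ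
Σℚ {suc k} f = f Fin.zero + Σℚ {k} (λ i → f (Fin.suc i))

-- p ∈ Root(Q) = Conv{u_a : a ∈ Arr(Q)}, for a point p ∈ ℚ^n:
-- p is a convex combination of the u_a with (rational) weights.
InRoot : ∀ {n m} → Quiver n m → (Fin n → ℚ) → Set
InRoot {n} Q p =
  ∃[ w ] ((∀ a → 0ℚ Data.Rational.≤ w a)
         × (Σℚ w ≡ Data.Rational.1ℚ)
         × (∀ (l : Fin n) →
              Σℚ (λ a → w a * toℚ (u (Quiver.arr Q a) l)) ≡ p l))

-- The coordinates of every u_a lie in {-1, 0, 1}, and u_a has at most one
-- coordinate equal to 1 (at its target) and at most one equal to -1 (at its
-- source). Let p ≠ 0 be a lattice point of Root(Q), written as a convex
-- combination of the u_a, and say p_l ≥ 1. Since every u_a has l-th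
-- coordinate at most 1, all arrows a carrying positive weight have
-- (u_a)_l = 1, hence target v_l. For those arrows every other coordinate
-- lies in {-1, 0}, so in each coordinate k their values lie in an interval
-- [c, c + 1] and average to the integer p_k; this forces them all to equal
-- p_k, i.e. p = u_a for any such a. The case p_l ≤ -1 is symmetric,
-- with sources in place of targets.

{-# OPTIONS --safe #-}
module Submission where

open import Defs
open import Data.Nat using (ℕ; _≥_; zero; suc; z≤n; z<s)
open import Data.Fin using (Fin; zero; suc)
import Data.Fin.Properties as Finₚ
open import Data.Sum using (_⊎_; inj₁; inj₂; [_,_]′)
open import Data.Sum.Properties using (inj₁-injective)
open import Data.Product using (∃; ∃-syntax; _×_; _,_; proj₁; proj₂)
open import Data.Integer as ℤ
  using (ℤ; +_; 0ℤ; 1ℤ; -1ℤ; -_; NonNegative; +≤+; +<+)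
import Data.Integer.Properties as ℤₚ
open import Data.Rational
  using (ℚ; 0ℚ; 1ℚ; mkℚ; _+_; _*_; _≤_; _<_; *≤*; *<*)
import Data.Rational.Properties as ℚₚ
import Data.Nat.Coprimality as C
open import Function using (_∘_)
open import Relation.Binary using (tri<; tri≈; tri>)
open import Relation.Binary.PropositionalEquality
  using (_≡_; _≢_; refl; sym; trans; cong; subst; subst₂)
open import Relation.Nullary using (yes; no)
open import Data.Empty using (⊥-elim)

toℚ≡mkℚ : ∀ z → toℚ z ≡ mkℚ z 0 (C.sym (C.1-coprimeTo ℤ.∣ z ∣))
toℚ≡mkℚ (+ n)      = ℚₚ.normalize-coprime (C.sym (C.1-coprimeTo n))
toℚ≡mkℚ ℤ.-[1+ n ] =
  cong Data.Rational.-_ (ℚₚ.normalize-coprime (C.sym (C.1-coprimeTo (suc n))))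

toℚ-mono-≤ : ∀ {i j} → i ℤ.≤ j → toℚ i ≤ toℚ j
toℚ-mono-≤ {i} {j} i≤j rewrite toℚ≡mkℚ i | toℚ≡mkℚ j =
  *≤* (subst₂ ℤ._≤_ (sym (ℤₚ.*-identityʳ i)) (sym (ℤₚ.*-identityʳ j)) i≤j)

toℚ-mono-< : ∀ {i j} → i ℤ.< j → toℚ i < toℚ j
toℚ-mono-< {i} {j} i<j rewrite toℚ≡mkℚ i | toℚ≡mkℚ j =
  *<* (subst₂ ℤ._<_ (sym (ℤₚ.*-identityʳ i)) (sym (ℤₚ.*-identityʳ j)) i<j)

toℚ-cancel-≤ : ∀ {i j} → toℚ i ≤ toℚ j → i ℤ.≤ j
toℚ-cancel-≤ {i} {j} le rewrite toℚ≡mkℚ i | toℚ≡mkℚ j =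
  subst₂ ℤ._≤_ (ℤₚ.*-identityʳ i) (ℤₚ.*-identityʳ j) (ℚₚ.drop-*≤* le)

≤-suc-cases : ∀ {i j} → i ℤ.≤ j → j ℤ.≤ ℤ.suc i → j ≡ i ⊎ j ≡ ℤ.suc i
≤-suc-cases {i} {j} i≤j j≤1+i with j ℤₚ.≟ i
... | yes j≡i = inj₁ j≡i
... | no  j≢i =
  inj₂ (ℤₚ.≤-antisym j≤1+i (ℤₚ.i<j⇒suc[i]≤j (ℤₚ.≤∧≢⇒< i≤j (j≢i ∘ sym))))

Σℚ-mono-≤ : ∀ {k} {f g : Fin k → ℚ} → (∀ a → f a ≤ g a) → Σℚ f ≤ Σℚ g
Σℚ-mono-≤ {zero}  f≤g = ℚₚ.≤-refl
Σℚ-mono-≤ {suc k} f≤g = ℚₚ.+-mono-≤ (f≤g zero) (Σℚ-mono-≤ (f≤g ∘ suc))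

Σℚ-mono-< : ∀ {k} {f g : Fin k → ℚ} → (∀ a → f a ≤ g a) →
            ∀ a → f a < g a → Σℚ f < Σℚ g
Σℚ-mono-< f≤g zero    f<g = ℚₚ.+-mono-<-≤ f<g (Σℚ-mono-≤ (f≤g ∘ suc))
Σℚ-mono-< f≤g (suc a) f<g = ℚₚ.+-mono-≤-< (f≤g zero) (Σℚ-mono-< (f≤g ∘ suc) a f<g)

Σℚ-*ʳ : ∀ {k} (f : Fin k → ℚ) c → Σℚ (λ a → f a * c) ≡ Σℚ f * c
Σℚ-*ʳ {zero}  f c = sym (ℚₚ.*-zeroˡ c)
Σℚ-*ʳ {suc k} f c = trans (cong (λ s → f zero * c + s) (Σℚ-*ʳ (f ∘ suc) c))
                          (sym (ℚₚ.*-distribʳ-+ c (f zero) (Σℚ (f ∘ suc))))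

Σℚ-0 : ∀ {k} → Σℚ {k} (λ _ → 0ℚ) ≡ 0ℚ
Σℚ-0 {zero}  = refl
Σℚ-0 {suc k} = trans (ℚₚ.+-identityˡ _) (Σℚ-0 {k})

module ConvexCombination
  {k} (w : Fin k → ℚ) (w≥0 : ∀ a → 0ℚ ≤ w a) (Σw≡1 : Σℚ w ≡ 1ℚ) where

  Supp : Fin k → Set
  Supp a = 0ℚ < w a

  mean : (Fin k → ℤ) → ℚ
  mean g = Σℚ (λ a → w a * toℚ (g a))

  UnitWindow : (Fin k → ℤ) → Set
  UnitWindow g = ∃[ c ] (∀ a → Supp a → c ℤ.≤ g a × g a ℤ.≤ ℤ.suc c)

  support-nonempty : ∃ Supp
  support-nonempty with Finₚ.any? (λ a → 0ℚ ℚₚ.<? w a)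
  ... | yes supp = supp
  ... | no ¬supp = ⊥-elim (ℚₚ.<-irrefl refl (ℚₚ.<-≤-trans 0<1 1≤0))
    where
    0<1 : 0ℚ < 1ℚ
    0<1 = ℚₚ.positive⁻¹ 1ℚ
    open ℚₚ.≤-Reasoning
    1≤0 : 1ℚ ≤ 0ℚ
    1≤0 = begin
      1ℚ                ≡⟨ sym Σw≡1 ⟩
      Σℚ w              ≤⟨ Σℚ-mono-≤ (λ a → ℚₚ.≮⇒≥ (¬supp ∘ (a ,_))) ⟩
      Σℚ {k} (λ _ → 0ℚ) ≡⟨ Σℚ-0 {k} ⟩
      0ℚ                ∎

  mean-const : ∀ c → mean (λ _ → c) ≡ toℚ c
  mean-const c = begin-equality
    Σℚ (λ a → w a * toℚ c) ≡⟨ Σℚ-*ʳ w (toℚ c) ⟩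
    Σℚ w * toℚ c           ≡⟨ cong (_* toℚ c) Σw≡1 ⟩
    1ℚ * toℚ c             ≡⟨ ℚₚ.*-identityˡ (toℚ c) ⟩
    toℚ c                  ∎
    where open ℚₚ.≤-Reasoning

  weighted-≤ : ∀ {a i j} → (Supp a → i ℤ.≤ j) → w a * toℚ i ≤ w a * toℚ j
  weighted-≤ {a} {i} {j} i≤j with 0ℚ ℚₚ.<? w a
  ... | yes 0<wa =
    ℚₚ.*-monoˡ-≤-nonNeg (w a) {{Data.Rational.nonNegative (w≥0 a)}}
                           (toℚ-mono-≤ (i≤j 0<wa))
  ... | no  0≮wa rewrite ℚₚ.≤-antisym (ℚₚ.≮⇒≥ 0≮wa) (w≥0 a) =
    subst₂ _≤_ (sym (ℚₚ.*-zeroˡ (toℚ i))) (sym (ℚₚ.*-zeroˡ (toℚ j))) ℚₚ.≤-refl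

  weighted-< : ∀ {a i j} → Supp a → i ℤ.< j → w a * toℚ i < w a * toℚ j
  weighted-< {a} 0<wa i<j =
    ℚₚ.*-monoʳ-<-pos (w a) {{Data.Rational.positive 0<wa}} (toℚ-mono-< i<j)

  mean-≤ : ∀ {g c} → (∀ a → Supp a → g a ℤ.≤ c) → mean g ≤ toℚ c
  mean-≤ {c = c} g≤c =
    subst (_ ≤_) (mean-const c) (Σℚ-mono-≤ (λ a → weighted-≤ (g≤c a)))

  mean-≥ : ∀ {g c} → (∀ a → Supp a → c ℤ.≤ g a) → toℚ c ≤ mean g
  mean-≥ {c = c} c≤g =
    subst (_≤ _) (mean-const c) (Σℚ-mono-≤ (λ a → weighted-≤ (c≤g a)))

  mean-≡-max : ∀ {g c} → (∀ a → Supp a → g a ℤ.≤ c) → toℚ c ≤ mean g →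
               ∀ a → Supp a → g a ≡ c
  mean-≡-max {g} {c} g≤c c≤mean a sa with g a ℤₚ.≟ c
  ... | yes ga≡c = ga≡c
  ... | no  ga≢c = ⊥-elim (ℚₚ.<-irrefl refl (ℚₚ.<-≤-trans mean<c c≤mean))
    where
    mean<c : mean g < toℚ c
    mean<c = subst (_ <_) (mean-const c)
      (Σℚ-mono-< (λ b → weighted-≤ (g≤c b)) a
                 (weighted-< sa (ℤₚ.≤∧≢⇒< (g≤c a sa) ga≢c)))

  mean-≡-min : ∀ {g c} → (∀ a → Supp a → c ℤ.≤ g a) → mean g ≤ toℚ c →
               ∀ a → Supp a → g a ≡ c
  mean-≡-min {g} {c} c≤g mean≤c a sa with g a ℤₚ.≟ c
  ... | yes ga≡c = ga≡c
  ... | no  ga≢c = ⊥-elim (ℚₚ.<-irrefl refl (ℚₚ.<-≤-trans c<mean mean≤c))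
    where
    c<mean : toℚ c < mean g
    c<mean = subst (_< _) (mean-const c)
      (Σℚ-mono-< (λ b → weighted-≤ (c≤g b)) a
                 (weighted-< sa (ℤₚ.≤∧≢⇒< (c≤g a sa) (ga≢c ∘ sym))))

  mean-integral : ∀ {g P} → UnitWindow g → mean g ≡ toℚ P → ∀ a → Supp a → g a ≡ P
  mean-integral {g} {P} (c , window) mean≡P =
    [ at-c , at-c+1 ]′ (≤-suc-cases c≤P P≤c+1)
    where
    c≤g : ∀ a → Supp a → c ℤ.≤ g a
    c≤g a = proj₁ ∘ window a
    g≤c+1 : ∀ a → Supp a → g a ℤ.≤ ℤ.suc c
    g≤c+1 a = proj₂ ∘ window a
    c≤P : c ℤ.≤ P
    c≤P = toℚ-cancel-≤ (subst (_ ≤_) mean≡P (mean-≥ c≤g))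
    P≤c+1 : P ℤ.≤ ℤ.suc c
    P≤c+1 = toℚ-cancel-≤ (subst (_≤ _) mean≡P (mean-≤ g≤c+1))
    at-c : P ≡ c → ∀ a → Supp a → g a ≡ P
    at-c P≡c a sa =
      trans (mean-≡-min c≤g (ℚₚ.≤-reflexive (trans mean≡P (cong toℚ P≡c))) a sa)
            (sym P≡c)
    at-c+1 : P ≡ ℤ.suc c → ∀ a → Supp a → g a ≡ P
    at-c+1 P≡c+1 a sa =
      trans (mean-≡-max g≤c+1 (ℚₚ.≤-reflexive (sym (trans mean≡P (cong toℚ P≡c+1))))
                        a sa)
            (sym P≡c+1)

δ-nonNeg : ∀ {n} (i l : Fin n) → NonNegative (δ i l)
δ-nonNeg zero    zero    = _
δ-nonNeg zero    (suc _) = _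
δ-nonNeg (suc _) zero    = _
δ-nonNeg (suc i) (suc l) = δ-nonNeg i l

δ-≤1 : ∀ {n} (i l : Fin n) → δ i l ℤ.≤ 1ℤ
δ-≤1 zero    zero    = ℤₚ.≤-refl
δ-≤1 zero    (suc _) = +≤+ z≤n
δ-≤1 (suc _) zero    = +≤+ z≤n
δ-≤1 (suc i) (suc l) = δ-≤1 i l

δ-pos⇒≡ : ∀ {n} (i l : Fin n) → 0ℤ ℤ.< δ i l → i ≡ l
δ-pos⇒≡ zero    zero    _   = refl
δ-pos⇒≡ (suc i) (suc l) 0<δ = cong suc (δ-pos⇒≡ i l 0<δ)
δ-pos⇒≡ zero    (suc _) (+<+ ())
δ-pos⇒≡ (suc _) zero    (+<+ ())

0≤δ : ∀ {n} (i l : Fin n) → 0ℤ ℤ.≤ δ i l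
0≤δ i l = ℤₚ.nonNegative⁻¹ (δ i l) {{δ-nonNeg i l}}

δ-difference-≤ : ∀ {n} (i j l : Fin n) → δ j l ℤ.- δ i l ℤ.≤ δ j l
δ-difference-≤ i j l = ℤₚ.i-j≤i (δ j l) (δ i l) {{δ-nonNeg i l}}

δ-difference-≥ : ∀ {n} (i j l : Fin n) → - δ i l ℤ.≤ δ j l ℤ.- δ i l
δ-difference-≥ i j l = ℤₚ.i≤j+i (- δ i l) (δ j l) {{δ-nonNeg j l}}

u≤1 : ∀ {n m} (x : Arrow n m) l → u x l ℤ.≤ 1ℤ
u≤1 (nn i j) l = ℤₚ.≤-trans (δ-difference-≤ i j l) (δ-≤1 j l)
u≤1 (sn s j) l = δ-≤1 j l
u≤1 (ns i s) l = ℤₚ.≤-trans (ℤₚ.neg-mono-≤ (0≤δ i l)) (+≤+ z≤n)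

-1≤u : ∀ {n m} (x : Arrow n m) l → -1ℤ ℤ.≤ u x l
-1≤u (nn i j) l = ℤₚ.≤-trans (ℤₚ.neg-mono-≤ (δ-≤1 i l)) (δ-difference-≥ i j l)
-1≤u (sn s j) l = ℤₚ.≤-trans ℤ.-≤+ (0≤δ j l)
-1≤u (ns i s) l = ℤₚ.neg-mono-≤ (δ-≤1 i l)

u-pos⇒target : ∀ {n m} (x : Arrow n m) l → 0ℤ ℤ.< u x l → target x ≡ inj₁ l
u-pos⇒target (nn i j) l 0<u =
  cong inj₁ (δ-pos⇒≡ j l (ℤₚ.<-≤-trans 0<u (δ-difference-≤ i j l)))
u-pos⇒target (sn s j) l 0<u = cong inj₁ (δ-pos⇒≡ j l 0<u)
u-pos⇒target (ns i s) l 0<u = ⊥-elim (ℤₚ.<⇒≱ 0<u (ℤₚ.neg-mono-≤ (0≤δ i l)))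

u-neg⇒source : ∀ {n m} (x : Arrow n m) l → u x l ℤ.< 0ℤ → source x ≡ inj₁ l
u-neg⇒source (nn i j) l u<0 =
  cong inj₁ (δ-pos⇒≡ i l (ℤₚ.neg-cancel-< (ℤₚ.≤-<-trans (δ-difference-≥ i j l) u<0)))
u-neg⇒source (sn s j) l u<0 = ⊥-elim (ℤₚ.<⇒≱ u<0 (0≤δ j l))
u-neg⇒source (ns i s) l u<0 = cong inj₁ (δ-pos⇒≡ i l (ℤₚ.neg-cancel-< u<0))

u-pos⇒others-≤0 : ∀ {n m} (x : Arrow n m) {k l} →
                  0ℤ ℤ.< u x l → k ≢ l → u x k ℤ.≤ 0ℤ
u-pos⇒others-≤0 x {k} {l} 0<uxl k≢l = ℤₚ.≮⇒≥ λ 0<uxk →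
  k≢l (inj₁-injective (trans (sym (u-pos⇒target x k 0<uxk)) (u-pos⇒target x l 0<uxl)))

u-neg⇒others-≥0 : ∀ {n m} (x : Arrow n m) {k l} →
                  u x l ℤ.< 0ℤ → k ≢ l → 0ℤ ℤ.≤ u x k
u-neg⇒others-≥0 x {k} {l} uxl<0 k≢l = ℤₚ.≮⇒≥ λ uxk<0 →
  k≢l (inj₁-injective (trans (sym (u-neg⇒source x k uxk<0)) (u-neg⇒source x l uxl<0)))

module _ {n m k} (arr : Fin k → Arrow n m)
         (w : Fin k → ℚ) (w≥0 : ∀ a → 0ℚ ≤ w a) (Σw≡1 : Σℚ w ≡ 1ℚ)
         (p : Fin n → ℤ) where

  open ConvexCombination w w≥0 Σw≡1

  coord : Fin n → Fin k → ℤ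
  coord l a = u (arr a) l

  module _ (mean≡p : ∀ l → mean (coord l) ≡ toℚ (p l)) where

    coord≡1-on-support : ∀ {l} → 0ℤ ℤ.< p l → ∀ a → Supp a → coord l a ≡ 1ℤ
    coord≡1-on-support {l} 0<pl = mean-≡-max (λ a _ → u≤1 (arr a) l)
      (subst (toℚ 1ℤ ≤_) (sym (mean≡p l)) (toℚ-mono-≤ (ℤₚ.i<j⇒suc[i]≤j 0<pl)))

    coord≡-1-on-support : ∀ {l} → p l ℤ.< 0ℤ → ∀ a → Supp a → coord l a ≡ -1ℤ
    coord≡-1-on-support {l} pl<0 = mean-≡-min (λ a _ → -1≤u (arr a) l)
      (subst (_≤ toℚ -1ℤ) (sym (mean≡p l)) (toℚ-mono-≤ (ℤₚ.i<j⇒i≤pred[j] pl<0)))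

    window-above : ∀ {l} → 0ℤ ℤ.< p l → ∀ k → UnitWindow (coord k)
    window-above {l} 0<pl k with k Finₚ.≟ l
    ... | yes refl = 0ℤ , λ a sa →
      subst (λ v → 0ℤ ℤ.≤ v × v ℤ.≤ 1ℤ) (sym (coord≡1-on-support 0<pl a sa))
            (+≤+ z≤n , ℤₚ.≤-refl)
    ... | no  k≢l = -1ℤ , λ a sa →
      -1≤u (arr a) k ,
      u-pos⇒others-≤0 (arr a)
        (subst (0ℤ ℤ.<_) (sym (coord≡1-on-support 0<pl a sa)) (+<+ z<s)) k≢l

    window-below : ∀ {l} → p l ℤ.< 0ℤ → ∀ k → UnitWindow (coord k)
    window-below {l} pl<0 k with k Finₚ.≟ l
    ... | yes refl = -1ℤ , λ a sa →
      subst (λ v → -1ℤ ℤ.≤ v × v ℤ.≤ 0ℤ) (sym (coord≡-1-on-support pl<0 a sa))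
            (ℤₚ.≤-refl , ℤ.-≤+)
    ... | no  k≢l = 0ℤ , λ a sa →
      u-neg⇒others-≥0 (arr a)
        (subst (ℤ._< 0ℤ) (sym (coord≡-1-on-support pl<0 a sa)) ℤ.-<+) k≢l ,
      u≤1 (arr a) k

    nonzero-lattice-point-is-some-u :
      ∃[ l ] p l ≢ 0ℤ → ∃[ a ] (∀ k → p k ≡ u (arr a) k)
    nonzero-lattice-point-is-some-u (l , pl≢0) =
      let (a , sa) = support-nonempty in
      a , λ k → sym (mean-integral (window k) (mean≡p k) a sa)
      where
      window : ∀ k → UnitWindow (coord k)
      window with ℤₚ.<-cmp 0ℤ (p l)
      ... | tri< 0<pl _ _ = window-above 0<pl
      ... | tri≈ _ 0≡pl _ = ⊥-elim (pl≢0 (sym 0≡pl))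
      ... | tri> _ _ pl<0 = window-below pl<0

proposition2p13 : (n m : ℕ) → n ≥ 1 → (Q : Quiver n m) → Connected Q →
    (p : Fin n → ℤ) → InRoot Q (λ l → toℚ (p l)) →
    (∀ l → p l ≡ + 0) ⊎ (∃[ a ] (∀ l → p l ≡ u (Quiver.arr Q a) l))
proposition2p13 n m _ Q _ p (w , w≥0 , Σw≡1 , mean≡p)
  with Finₚ.all? (λ l → p l ℤₚ.≟ 0ℤ)
... | yes p≡0 = inj₁ p≡0
... | no  p≢0 = inj₂ (nonzero-lattice-point-is-some-u (Quiver.arr Q) w w≥0 Σw≡1 p mean≡p
                       (Finₚ.¬∀⟶∃¬ n _ (λ l → p l ℤₚ.≟ 0ℤ) p≢0))
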